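{- Every ordinal $\alpha$, seen as the relational structure $(\alpha,\le)$, is well structured.
   Context: Embeddings of $(\alpha,\le)$ are the maps $\alpha\to\alpha$ preserving and reflecting $\le$ (i.e. strictly monotone maps). A quasi order $(Y,\preceq)$ is a well quasi order (wqo) if every infinite sequence $y_1,y_2,\dots$ contains $i<j$ with $y_i\preceq y_j$. For a relational structure $\mathcal{A}=(A,\dots)$ and quasi order $(Y,\preceq)$, consider all labellings $\ell:B\to Y$ of finite subsets $B\subseteq A$, quasi ordered by $\ell\rightsquigarrow\ell'$ (for $\ell':B'\to Y$) iff there is an embedding $\iota$ of $\mathcal{A}$ with $\iota(B)\subseteq B'$ and $\ell(b)\preceq\ell'(\iota(b))$ for all $b\in B$. $\mathcal{A}$ is well structured if for every wqo $(Y,\preceq)$ the quasi order $\rightsquigarrow$ on $Y$-labellings is a wqo. -}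

module Defs where

open import Level using (Level; _⊔_; suc; Setω)
open import Data.Nat using (ℕ) renaming (_<_ to _<ℕ_)
open import Data.Product using (Σ; ∃; _×_; _,_; proj₁; proj₂)
open import Data.Sum using (_⊎_)
open import Data.List using (List; map)
open import Data.List.Relation.Unary.All using (All)
open import Data.List.Relation.Unary.Any using (Any)
open import Data.List.Relation.Unary.AllPairs using (AllPairs)
open import Relation.Nullary using (Dec; ¬_)
open import Relation.Binary using (Rel; IsPreorder; IsStrictTotalOrder)
open import Relation.Binary.PropositionalEquality using (_≡_; _≢_)
open import Induction.WellFounded using (WellFounded)

-- Excluded middle (the paper works in classical set theory).
LEM : Setω
LEM = ∀ {p} (P : Set p) → Dec P

record Ordinal (a ℓ : Level) : Set (Level.suc (a ⊔ ℓ)) where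
  field
    Carrier            : Set a
    _<_                : Rel Carrier ℓ
    isStrictTotalOrder : IsStrictTotalOrder _≡_ _<_
    wellFounded        : WellFounded _<_

  _≤_ : Rel Carrier (a ⊔ ℓ)
  x ≤ y = (x < y) ⊎ (x ≡ y)

  IsEmbedding : (Carrier → Carrier) → Set (a ⊔ ℓ)
  IsEmbedding f = ∀ x y → ((x ≤ y → f x ≤ f y) × (f x ≤ f y → x ≤ y))

IsWQO : ∀ {y r} {Y : Set y} → Rel Y r → Set (y ⊔ r)
IsWQO {Y = Y} _≼_ =
  IsPreorder _≡_ _≼_ × (∀ (s : ℕ → Y) → ∃ λ i → ∃ λ j → (i <ℕ j) × (s i ≼ s j))

module _ {a ℓ} (α : Ordinal a ℓ) where
  open Ordinal α

  -- A Y-labelling of a finite subset B ⊆ α: a finite list of pairs (b , ℓ(b))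
  -- whose first components are pairwise distinct (they enumerate B).
  Labelling : ∀ {y} → Set y → Set (a ⊔ y)
  Labelling Y = Σ (List (Carrier × Y)) λ l → AllPairs _≢_ (map proj₁ l)

  _⇝_ : ∀ {y r} {Y : Set y} (_≼_ : Rel Y r) → Rel (Labelling Y) (a ⊔ ℓ ⊔ r ⊔ y)
  (_≼_ ⇝ (l , _)) (l' , _) =
    Σ (Carrier → Carrier) λ ι → IsEmbedding ι ×
      All (λ p → Any (λ q → (proj₁ q ≡ ι (proj₁ p)) × (proj₂ p ≼ proj₂ q)) l') l

  WellStructured : Setω
  WellStructured = ∀ {y r} (Y : Set y) (_≼_ : Rel Y r) → IsWQO _≼_ → IsWQO (_⇝_ _≼_)

{-# OPTIONS --safe #-}
module Submission where

-- Enumerate a labelling increasingly as b₁ < ⋯ < bₙ and record, for each gap (bᵢ₋₁, bᵢ) and for the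
-- final segment above bₙ, its order type (an element of α, or ⊤ when it is α itself), together with
-- the labels. This gives a finite word over (α ∪ {⊤}) × (Y ∪ {⊥}), whose letter order is a wqo because α
-- is well ordered. By Higman's lemma (minimal bad sequence argument) the word of some labelling embeds
-- into the word of a later one. Gap by gap, a smaller order type yields a strictly monotone map between
-- the gaps (compose the collapse of one gap onto an initial segment of α with the inverse collapse of
-- the other); glued together at the labelled points these form an embedding of α witnessing ⇝.

open import Defs
open import Level using (Level; _⊔_)
open import Function using (_∘_)
open import Data.Empty using (⊥-elim)
open import Data.Maybe using (fromMaybe)
open import Data.Product using (Σ; ∃; ∃₂; _×_; _,_; proj₁; proj₂)
open import Data.Product.Relation.Binary.Pointwise.NonDependent using (Pointwise; ×-transitive)
open import Data.Sum using (_⊎_; inj₁; inj₂)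
open import Data.Nat using (ℕ; zero; suc; _∸_; z≤n; s≤s) renaming (_<_ to _<ℕ_; _≤_ to _≤ℕ_; _<?_ to _<ℕ?_)
import Data.Nat.Properties as ℕ
open import Data.Nat.Induction using (<-wellFounded)
open import Data.List using (List; []; _∷_; map; length)
open import Data.List.Relation.Unary.All as All using (All; []; _∷_; lookupAny)
open import Data.List.Relation.Unary.All.Properties using (map⁻)
open import Data.List.Relation.Unary.Any as Any using (Any; here; there)
open import Data.List.Relation.Unary.AllPairs using (AllPairs; []; _∷_)
open import Data.List.Relation.Binary.Permutation.Propositional
  using (_↭_; prep; swap; ↭-refl; ↭-sym; ↭-trans)
open import Data.List.Relation.Binary.Permutation.Propositional.Properties using (All-resp-↭; Any-resp-↭)
open import Data.List.Relation.Binary.Sublist.Heterogeneous using (Sublist; _∷_; _∷ʳ_; minimum)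
open import Relation.Nullary using (¬_; yes; no)
open import Relation.Nullary.Decidable using (decidable-stable)
open import Relation.Nullary.Construct.Add.Infimum using (_₋; ⊥₋; [_])
open import Relation.Binary using (Rel; Transitive; IsPreorder; IsStrictTotalOrder; tri<; tri≈; tri>)
import Relation.Binary.Construct.StrictToNonStrict as StrictToNonStrict
open import Relation.Binary.Construct.Add.Infimum.NonStrict using (_≤₋_; ⊥₋≤_; [_]; ≤₋-trans)
open import Relation.Binary.PropositionalEquality using (_≡_; _≢_; refl; sym; trans; cong; subst; subst₂)
import Relation.Binary.PropositionalEquality as ≡
open import Relation.Nullary.Construct.Add.Supremum using (_⁺; ⊤⁺)
open import Induction.WellFounded using (WellFounded; Acc; acc; module FixPoint)
import Induction.WellFounded as WF

Good : ∀ {a r} {A : Set a} → Rel A r → (ℕ → A) → Set r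
Good _≤_ s = ∃ λ i → ∃ λ j → i <ℕ j × s i ≤ s j

WellQuasi : ∀ {a r} {A : Set a} → Rel A r → Set (a ⊔ r)
WellQuasi _≤_ = ∀ s → Good _≤_ s

chain : ∀ {a r} {A : Set a} (R : Rel A r) → Transitive R → (t : ℕ → A) →
        (∀ n → R (t n) (t (suc n))) → ∀ {i j} → i <ℕ j → R (t i) (t j)
chain R R-trans t step {i} {suc j} (s≤s i≤j) with ℕ.m≤n⇒m<n∨m≡n i≤j
... | inj₁ i<j  = R-trans (chain R R-trans t step i<j) (step j)
... | inj₂ refl = step i

dependent-choice : ∀ {a p q} {A : Set a} {P : A → Set p} {Q : A → A → Set q} →
                   (∀ {x} → P x → ∃ λ y → P y × Q x y) → ∀ {x} → P x →
                   ∃ λ (f : ℕ → A) → (∀ n → P (f n)) × (∀ n → Q (f n) (f (suc n)))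
dependent-choice {A = A} {P} step {x} px =
  proj₁ ∘ seq , proj₂ ∘ seq , λ n → proj₂ (proj₂ (step (proj₂ (seq n))))
  where
  seq : ℕ → Σ A P
  seq zero    = x , px
  seq (suc n) = proj₁ (step (proj₂ (seq n))) , proj₁ (proj₂ (step (proj₂ (seq n))))

splice : ∀ {b} {B : Set b} → ℕ → (ℕ → B) → (ℕ → B) → ℕ → B
splice N s u k with k <ℕ? N
... | yes _ = s k
... | no _  = u (k ∸ N)

module _ {b} {B : Set b} {N : ℕ} {s u : ℕ → B} where

  splice-< : ∀ {k} → k <ℕ N → splice N s u k ≡ s k
  splice-< {k} k<N with k <ℕ? N
  ... | yes _  = refl
  ... | no k≮N = ⊥-elim (k≮N k<N)

  splice-≥ : ∀ {k} → N ≤ℕ k → splice N s u k ≡ u (k ∸ N)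
  splice-≥ {k} N≤k with k <ℕ? N
  ... | yes k<N = ⊥-elim (ℕ.<⇒≱ k<N N≤k)
  ... | no _    = refl

module Labellings {a ℓ} (α : Ordinal a ℓ) {y r} {Y : Set y} (_≼_ : Rel Y r) where
  open Ordinal α renaming (Carrier to C)

  Lifts : (C → C) → C × Y → C × Y → Set (a ⊔ r)
  Lifts ι p q = proj₁ q ≡ ι (proj₁ p) × proj₂ p ≼ proj₂ q

  Carries : (C → C) → List (C × Y) → List (C × Y) → Set (a ⊔ y ⊔ r)
  Carries ι l l' = All (λ p → Any (Lifts ι p) l') l

  carries-resp : ∀ {ι ι' l l'} → All (λ p → ι (proj₁ p) ≡ ι' (proj₁ p)) l → Carries ι l l' → Carries ι' l l'
  carries-resp ι≗ι' carries =
    All.zipWith (λ (eq , any) → Any.map (λ (q≡ι , ≼q) → trans q≡ι eq , ≼q) any) (ι≗ι' , carries)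

  carries-↭ : ∀ {ι L L' l l'} → L ↭ l → L' ↭ l' → Carries ι L L' → Carries ι l l'
  carries-↭ L↭l L'↭l' carries = All-resp-↭ L↭l (All.map (Any-resp-↭ L'↭l') carries)

  id-embedding : IsEmbedding (λ x → x)
  id-embedding _ _ = (λ x≤y → x≤y) , (λ x≤y → x≤y)

  ∘-embedding : ∀ {f g} → IsEmbedding f → IsEmbedding g → IsEmbedding (g ∘ f)
  ∘-embedding f-emb g-emb x y =
    proj₁ (g-emb _ _) ∘ proj₁ (f-emb x y) , proj₂ (f-emb x y) ∘ proj₂ (g-emb _ _)

  module _ (≼-isPreorder : IsPreorder _≡_ _≼_) where
    open IsPreorder ≼-isPreorder using () renaming (refl to ≼-refl; trans to ≼-trans)

    ⇝-reflexive : ∀ {l l'} → l ≡ l' → _⇝_ α _≼_ l l'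
    ⇝-reflexive refl = (λ x → x) , id-embedding , All.tabulate (Any.map λ { refl → refl , ≼-refl })

    carries-∘ : ∀ {ι ι' l l' l''} → Carries ι l l' → Carries ι' l' l'' → Carries (ι' ∘ ι) l l''
    carries-∘ {ι} {ι'} {l' = l'} {l''} carries carries' = All.map compose carries
      where
      compose : ∀ {p} → Any (Lifts ι p) l' → Any (Lifts (ι' ∘ ι) p) l''
      compose p↦l' with lookupAny carries' p↦l'
      ... | q↦l'' , (q≡ιp , p≼q) =
            Any.map (λ (r≡ι'q , q≼r) → trans r≡ι'q (cong ι' q≡ιp) , ≼-trans p≼q q≼r) q↦l''

    ⇝-trans : Transitive (_⇝_ α _≼_)
    ⇝-trans (ι , ι-emb , carries) (ι' , ι'-emb , carries') =
      ι' ∘ ι , ∘-embedding ι-emb ι'-emb , carries-∘ carries carries'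

    ⇝-isPreorder : IsPreorder _≡_ (_⇝_ α _≼_)
    ⇝-isPreorder = record
      { isEquivalence = ≡.isEquivalence
      ; reflexive     = ⇝-reflexive
      -- ⇝ ignores the distinctness proofs, so the middle labelling cannot be inferred.
      ; trans         = λ {l} {l'} {l''} → ⇝-trans {l} {l'} {l''}
      }

module Classical (lem : LEM) where

  stable : ∀ {p} {P : Set p} → ¬ ¬ P → P
  stable = decidable-stable (lem _)

  ¬∀⇒∃¬ : ∀ {a p q} {A : Set a} {P : A → Set p} {Q : A → Set q} →
          ¬ (∀ {x} → P x → Q x) → ∃ λ x → P x × ¬ Q x
  ¬∀⇒∃¬ ¬∀ = stable λ ¬∃ → ¬∀ λ {x} px → stable λ ¬qx → ¬∃ (x , px , ¬qx)

  ε : ∀ {a p} {A : Set a} (P : A → Set p) → A → A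
  ε P default with lem (∃ P)
  ... | yes (x , _) = x
  ... | no _        = default

  ε-spec : ∀ {a p} {A : Set a} {P : A → Set p} default → ∃ P → P (ε P default)
  ε-spec {P = P} default ∃P with lem (∃ P)
  ... | yes (_ , px) = px
  ... | no ¬∃P       = ⊥-elim (¬∃P ∃P)

  minimal : ∀ {a r p} {A : Set a} {_<_ : Rel A r} → WellFounded _<_ → {P : A → Set p} →
            ∃ P → ∃ λ m → P m × ∀ {y} → P y → ¬ y < m
  minimal {_<_ = _<_} wf {P} (x , px) = stable λ ¬minimal → nothing-below ¬minimal (wf x) px
    where
    nothing-below : ¬ (∃ λ m → P m × ∀ {y} → P y → ¬ y < m) → ∀ {x} → Acc _<_ x → ¬ P x
    nothing-below ¬minimal (acc rs) px = ¬minimal (_ , px , λ py y<x → nothing-below ¬minimal (rs y<x) py)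

  module _ {a r} {A : Set a} {_≤_ : Rel A r} (≤-wq : WellQuasi _≤_) where

    Extendable : (ℕ → A) → ℕ → Set r
    Extendable s k = ∃ λ j → k <ℕ j × s k ≤ s j

    finitely-many-terminal : ∀ s → ¬ (∀ N → ∃ λ k → N ≤ℕ k × ¬ Extendable s k)
    finitely-many-terminal s terminal-after
      with dependent-choice next-terminal (proj₂ (proj₂ (terminal-after 0)))
      where
      next-terminal : ∀ {k} → ¬ Extendable s k → ∃ λ j → ¬ Extendable s j × k <ℕ j
      next-terminal {k} _ with terminal-after (suc k)
      ... | j , k<j , j-terminal = j , j-terminal , k<j
    ... | g , g-terminal , g-step with ≤-wq (s ∘ g)
    ...   | i , j , i<j , gi≤gj = g-terminal i (g j , chain _<ℕ_ ℕ.<-trans g g-step i<j , gi≤gj)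

    eventually-extendable : ∀ s → ∃ λ N → ∀ {k} → N ≤ℕ k → Extendable s k
    eventually-extendable s =
      stable λ ¬ev → finitely-many-terminal s λ N → ¬∀⇒∃¬ λ ext → ¬ev (N , λ {k} → ext {k})

    ascending-subsequence : Transitive _≤_ → ∀ s → ∃ λ (f : ℕ → ℕ) →
                            ∀ {i j} → i <ℕ j → f i <ℕ f j × s (f i) ≤ s (f j)
    ascending-subsequence ≤-trans s with eventually-extendable s
    ... | N , extend with dependent-choice next (ℕ.≤-refl {N})
      where
      next : ∀ {k} → N ≤ℕ k → ∃ λ j → N ≤ℕ j × k <ℕ j × s k ≤ s j
      next N≤k with extend N≤k
      ... | j , k<j , sk≤sj = j , ℕ.≤-trans N≤k (ℕ.<⇒≤ k<j) , k<j , sk≤sj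
    ... | f , _ , f-step = f , chain Step step-trans f f-step
      where
      Step : Rel ℕ r
      Step k j = k <ℕ j × s k ≤ s j
      step-trans : Transitive Step
      step-trans (k<j , sk≤sj) (j<l , sj≤sl) = ℕ.<-trans k<j j<l , ≤-trans sk≤sj sj≤sl

  ×-wellQuasi : ∀ {a b r q} {A : Set a} {B : Set b} {R : Rel A r} {Q : Rel B q} →
                Transitive R → WellQuasi R → WellQuasi Q → WellQuasi (Pointwise R Q)
  ×-wellQuasi {R = R} R-trans R-wq Q-wq s =
    let f , f-asc = ascending-subsequence {_≤_ = R} R-wq R-trans (proj₁ ∘ s)
        i , j , i<j , Q-ij = Q-wq (proj₂ ∘ s ∘ f)
    in f i , f j , proj₁ (f-asc i<j) , proj₂ (f-asc i<j) , Q-ij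

  ⊥₋-or-lifted : ∀ {a} {A : Set a} (s : ℕ → A ₋) →
                 (∃ λ k → s k ≡ ⊥₋) ⊎ (∃ λ (t : ℕ → A) → ∀ k → s k ≡ [ t k ])
  ⊥₋-or-lifted s with lem (∃ λ k → s k ≡ ⊥₋)
  ... | yes has-⊥₋ = inj₁ has-⊥₋
  ... | no ¬⊥₋    = inj₂ (proj₁ ∘ content , proj₂ ∘ content)
    where
    content : ∀ k → ∃ λ y → s k ≡ [ y ]
    content k with s k in eq
    ... | [ y ] = y , refl
    ... | ⊥₋    = ⊥-elim (¬⊥₋ (k , eq))

  ≤₋-wellQuasi : ∀ {a r} {A : Set a} {_≤_ : Rel A r} → WellQuasi _≤_ → WellQuasi (_≤₋_ _≤_)
  ≤₋-wellQuasi {_≤_ = _≤_} ≤-wq s with ⊥₋-or-lifted s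
  ... | inj₁ (k , sk≡⊥₋) = k , suc k , ℕ.n<1+n k , subst (λ x → _≤₋_ _≤_ x (s (suc k))) (sym sk≡⊥₋) (⊥₋≤ _)
  ... | inj₂ (t , s≡[t]) with ≤-wq t
  ...   | i , j , i<j , ti≤tj = i , j , i<j , subst₂ (_≤₋_ _≤_) (sym (s≡[t] i)) (sym (s≡[t] j)) [ ti≤tj ]

  well-founded⇒wellQuasi : ∀ {a r ℓ} {A : Set a} {_<_ : Rel A ℓ} {_≤_ : Rel A r} → WellFounded _<_ →
                           (∀ {x y} → ¬ y < x → x ≤ y) → WellQuasi _≤_
  well-founded⇒wellQuasi wf ≮⇒≥ s with minimal wf {λ v → ∃ λ k → s k ≡ v} (s 0 , 0 , refl)
  ... | _ , (k , refl) , sk-minimal = k , suc k , ℕ.n<1+n k , ≮⇒≥ (sk-minimal (suc k , refl))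

  module Higman {a r} {A : Set a} {_≤_ : Rel A r} (≤-trans : Transitive _≤_) (≤-wq : WellQuasi _≤_) where

    _≤*_ : Rel (List A) (a ⊔ r)
    _≤*_ = Sublist _≤_

    Bad : (ℕ → List A) → Set (a ⊔ r)
    Bad s = ∀ {i j} → i <ℕ j → ¬ s i ≤* s j

    AgreeBelow : ℕ → (ℕ → List A) → (ℕ → List A) → Set a
    AgreeBelow n s t = ∀ {i} → i <ℕ n → s i ≡ t i

    ShortestAt : ℕ → (ℕ → List A) → Set (a ⊔ r)
    ShortestAt n m = ∀ t → Bad t → AgreeBelow n m t → length (m n) ≤ℕ length (t n)

    MinimalBad : (ℕ → List A) → Set (a ⊔ r)
    MinimalBad m = Bad m × ∀ n → ShortestAt n m

    shortest-at : ∀ n s → Bad s → ∃ λ m → Bad m × AgreeBelow n s m × ShortestAt n m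
    shortest-at n s s-bad with minimal <-wellFounded {P = Candidate} (_ , s , s-bad , (λ _ → refl) , refl)
      where
      Candidate : ℕ → Set (a ⊔ r)
      Candidate len = ∃ λ t → Bad t × AgreeBelow n s t × length (t n) ≡ len
    ... | _ , (m , m-bad , s≈m , refl) , shortest =
          m , m-bad , s≈m , λ t t-bad m≈t →
            ℕ.≮⇒≥ (shortest (t , t-bad , (λ i<n → trans (s≈m i<n) (m≈t i<n)) , refl))

    minimal-bad : ∀ s → Bad s → ∃ MinimalBad
    minimal-bad s s-bad = m , m-bad , m-shortest
      where
      stage : ℕ → Σ (ℕ → List A) Bad
      refine : ∀ n → ∃ λ m → Bad m × AgreeBelow n (proj₁ (stage n)) m × ShortestAt n m
      stage zero    = s , s-bad
      stage (suc n) = proj₁ (refine n) , proj₁ (proj₂ (refine n))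
      refine n = shortest-at n (proj₁ (stage n)) (proj₂ (stage n))

      m : ℕ → List A
      m i = proj₁ (stage (suc i)) i

      settled : ∀ {i k} → i <ℕ k → proj₁ (stage k) i ≡ m i
      settled {i} {suc k} (s≤s i≤k) with ℕ.m≤n⇒m<n∨m≡n i≤k
      ... | inj₁ i<k  = trans (sym (proj₁ (proj₂ (proj₂ (refine k))) i<k)) (settled i<k)
      ... | inj₂ refl = refl

      m-bad : Bad m
      m-bad {i} {j} i<j mi≤mj =
        proj₂ (stage (suc j)) i<j (subst (_≤* m j) (sym (settled (ℕ.m<n⇒m<1+n i<j))) mi≤mj)

      m-shortest : ∀ n → ShortestAt n m
      m-shortest n t t-bad m≈t =
        proj₂ (proj₂ (proj₂ (refine n))) t t-bad λ i<n → trans (settled (ℕ.m<n⇒m<1+n i<n)) (m≈t i<n)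

    -- Keep m below f 0, then continue with the tails w (f 0), w (f 1), …: since the heads x ∘ f
    -- ascend, an embedding between two tails extends to one between the full words of m.
    module Graft {m} (m-bad : Bad m) {x : ℕ → A} {w : ℕ → List A} (m≡x∷w : ∀ n → m n ≡ x n ∷ w n)
                 {f : ℕ → ℕ} (f-asc : ∀ {i j} → i <ℕ j → f i <ℕ f j × x (f i) ≤ x (f j)) where

      grafted : ℕ → List A
      grafted = splice (f 0) m (w ∘ f)

      before : ∀ {k} → k <ℕ f 0 → grafted k ≡ m k
      before = splice-<

      after : ∀ {k} → f 0 ≤ℕ k → grafted k ≡ w (f (k ∸ f 0))
      after = splice-≥

      f0≤f : ∀ n → f 0 ≤ℕ f n
      f0≤f zero    = ℕ.≤-refl
      f0≤f (suc n) = ℕ.<⇒≤ (proj₁ (f-asc (s≤s z≤n)))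

      grafted-bad : Bad grafted
      grafted-bad {i} {j} i<j with ℕ.≤-<-connex (f 0) i | ℕ.≤-<-connex (f 0) j
      ... | inj₂ i<N | inj₂ j<N rewrite before i<N | before j<N = m-bad i<j
      ... | inj₂ i<N | inj₁ N≤j rewrite before i<N | after N≤j = λ mi≤wj →
            m-bad (ℕ.<-≤-trans i<N (f0≤f (j ∸ f 0))) (subst (m i ≤*_) (sym (m≡x∷w _)) (_ ∷ʳ mi≤wj))
      ... | inj₁ N≤i | inj₂ j<N = ⊥-elim (ℕ.<⇒≱ (ℕ.<-trans i<j j<N) N≤i)
      ... | inj₁ N≤i | inj₁ N≤j rewrite after N≤i | after N≤j = λ wi≤wj →
            m-bad (proj₁ (f-asc shifted))
                  (subst₂ _≤*_ (sym (m≡x∷w _)) (sym (m≡x∷w _)) (proj₂ (f-asc shifted) ∷ wi≤wj))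
        where
        shifted : i ∸ f 0 <ℕ j ∸ f 0
        shifted = ℕ.∸-monoˡ-< i<j N≤i

      grafted-agrees : AgreeBelow (f 0) m grafted
      grafted-agrees i<N = sym (before i<N)

      grafted-shorter : length (grafted (f 0)) <ℕ length (m (f 0))
      grafted-shorter rewrite after (ℕ.≤-refl {f 0}) | ℕ.n∸n≡0 (f 0) | m≡x∷w (f 0) = ℕ.≤-refl

    bad⇒nonempty : ∀ {m} → Bad m → ∀ n → ∃₂ λ x w → m n ≡ x ∷ w
    bad⇒nonempty {m} m-bad n with m n in eq
    ... | x ∷ w = x , w , refl
    ... | []    = ⊥-elim (m-bad (ℕ.n<1+n n) (subst (_≤* m (suc n)) (sym eq) (minimum _)))

    ¬minimal-bad : ∀ {m} → ¬ MinimalBad m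
    ¬minimal-bad (m-bad , m-shortest) =
      let f , f-asc = ascending-subsequence {_≤_ = _≤_} ≤-wq ≤-trans (proj₁ ∘ bad⇒nonempty m-bad)
          open Graft m-bad (λ n → proj₂ (proj₂ (bad⇒nonempty m-bad n))) f-asc
      in ℕ.<⇒≱ grafted-shorter (m-shortest (f 0) grafted grafted-bad grafted-agrees)

    higman : WellQuasi _≤*_
    higman s = stable λ ¬good →
      ¬minimal-bad (proj₂ (minimal-bad s λ i<j si≤sj → ¬good (_ , _ , i<j , si≤sj)))

  module Intervals {a ℓ} (α : Ordinal a ℓ) where
    open Ordinal α renaming (Carrier to C)
    open IsStrictTotalOrder isStrictTotalOrder using (compare; <-resp-≈; <-respʳ-≈; <-respˡ-≈)
      renaming (trans to <-trans; irrefl to <-irrefl; asym to <-asym)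
    open import Relation.Binary.Construct.Add.Infimum.Strict _<_
      using (_<₋_; ⊥₋<[_]; [_]; <₋-trans) renaming ([<]-injective to [<₋]-injective)
    open import Relation.Binary.Construct.Add.Supremum.Strict _<_
      using (_<⁺_; [_]; [_]<⊤⁺; <⁺-trans; <⁺-transˡ) renaming ([<]-injective to [<⁺]-injective)
    open import Relation.Binary.Construct.Add.Supremum.NonStrict _≤_ using (_≤⁺_; [_]; _≤⊤⁺)

    ≤-trans : Transitive _≤_
    ≤-trans = StrictToNonStrict.trans _≡_ _<_ ≡.isEquivalence <-resp-≈ <-trans

    <-≤-trans : ∀ {x y z} → x < y → y ≤ z → x < z
    <-≤-trans = StrictToNonStrict.<-≤-trans _≡_ _<_ <-trans <-respʳ-≈

    ≤-<-trans : ∀ {x y z} → x ≤ y → y < z → x < z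
    ≤-<-trans = StrictToNonStrict.≤-<-trans _≡_ _<_ sym <-trans <-respˡ-≈

    ≮⇒≥ : ∀ {x y} → ¬ y < x → x ≤ y
    ≮⇒≥ {x} {y} y≮x with compare x y
    ... | tri< x<y _ _ = inj₁ x<y
    ... | tri≈ _ x≡y _ = inj₂ x≡y
    ... | tri> _ _ y<x = ⊥-elim (y≮x y<x)

    ≤⇒≯ : ∀ {x y} → x ≤ y → ¬ y < x
    ≤⇒≯ (inj₁ x<y)  y<x = <-asym x<y y<x
    ≤⇒≯ (inj₂ refl) x<x = <-irrefl refl x<x

    _∈⟨_,_⟩ : C → C ₋ → C ⁺ → Set (a ⊔ ℓ)
    x ∈⟨ lo , hi ⟩ = lo <₋ [ x ] × [ x ] <⁺ hi

    StrictlyMonotoneOn : ∀ {p} → (C → Set p) → (C → C) → Set (a ⊔ ℓ ⊔ p)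
    StrictlyMonotoneOn I f = ∀ {x y} → I x → I y → x < y → f x < f y

    reflects : ∀ {p} {I : C → Set p} {f} → StrictlyMonotoneOn I f → ∀ {x y} → I x → I y → f x < f y → x < y
    reflects {f = f} f-mono {x} {y} Ix Iy fx<fy with compare x y
    ... | tri< x<y _ _  = x<y
    ... | tri≈ _ refl _ = ⊥-elim (<-irrefl refl fx<fy)
    ... | tri> _ _ y<x  = ⊥-elim (<-asym fx<fy (f-mono Iy Ix y<x))

    minimal-unique : ∀ {p} {P : C → Set p} {m m'} → (∀ {y} → P y → ¬ y < m) → (∀ {y} → P y → ¬ y < m') →
                     P m → P m' → m ≡ m'
    minimal-unique {m = m} {m'} m-min m'-min pm pm' with compare m m'
    ... | tri< m<m' _ _ = ⊥-elim (m'-min pm m<m')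
    ... | tri≈ _ m≡m' _ = m≡m'
    ... | tri> _ _ m'<m = ⊥-elim (m-min pm' m'<m)

    abstract
      least : ∀ {p} → (C → Set p) → C ⁺
      least P with lem (∃ P)
      ... | yes ∃P = [ proj₁ (minimal wellFounded ∃P) ]
      ... | no _   = ⊤⁺

      least-sound : ∀ {p} {P : C → Set p} {m} → least P ≡ [ m ] → P m
      least-sound {P = P} eq with lem (∃ P) | eq
      ... | yes ∃P | refl = proj₁ (proj₂ (minimal wellFounded ∃P))
      ... | no _   | ()

      least-minimal : ∀ {p} {P : C → Set p} {v} → P v → least P ≤⁺ [ v ]
      least-minimal {P = P} {v} pv with lem (∃ P)
      ... | yes ∃P = [ ≮⇒≥ (proj₂ (proj₂ (minimal wellFounded ∃P)) pv) ]
      ... | no ¬∃P = ⊥-elim (¬∃P (v , pv))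

      below-least : ∀ {p} {P : C → Set p} {v} → [ v ] <⁺ least P → ¬ P v
      below-least {P = P} {v} v<least pv with lem (∃ P) | v<least
      ... | yes ∃P | [ v<m ] = proj₂ (proj₂ (minimal wellFounded ∃P)) pv v<m
      ... | no ¬∃P | _       = ¬∃P (v , pv)

      least-cong : ∀ {p q} {P : C → Set p} {Q : C → Set q} →
                   (∀ {v} → P v → Q v) → (∀ {v} → Q v → P v) → least P ≡ least Q
      least-cong {P = P} {Q} P⇒Q Q⇒P with lem (∃ P) | lem (∃ Q)
      ... | yes ∃P       | yes ∃Q with minimal wellFounded ∃P | minimal wellFounded ∃Q
      ...   | m , pm , m-min | m' , qm' , m'-min =
              cong [_] (minimal-unique (λ qy → m-min (Q⇒P qy)) m'-min (P⇒Q pm) qm')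
      least-cong P⇒Q Q⇒P | yes (v , pv) | no ¬∃Q = ⊥-elim (¬∃Q (v , P⇒Q pv))
      least-cong P⇒Q Q⇒P | no ¬∃P | yes (v , qv) = ⊥-elim (¬∃P (v , Q⇒P qv))
      least-cong P⇒Q Q⇒P | no _   | no _         = refl

    -- collapse lo is the Mostowski collapse of the final segment above lo onto an initial segment of α.
    module Collapse (lo : C ₋) where

      AboveAll : (x : C) → (∀ {y} → y < x → C) → C → Set (a ⊔ ℓ)
      AboveAll x g v = ∀ {y} (y∈ : y ∈⟨ lo , [ x ] ⟩) → g ([<⁺]-injective (proj₂ y∈)) < v

      -- The default x is never used: see above-self.
      next : (x : C) → (∀ {y} → y < x → C) → C
      next x g = fromMaybe x (least (AboveAll x g))

      next-ext : ∀ x {g g' : ∀ {y} → y < x → C} →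
                 (∀ {y} (y<x : y < x) → g y<x ≡ g' y<x) → next x g ≡ next x g'
      next-ext x g≗g' = cong (fromMaybe x) (least-cong
        (λ above y∈ → subst (_< _) (g≗g' _) (above y∈))
        (λ above y∈ → subst (_< _) (sym (g≗g' _)) (above y∈)))

      abstract
        collapse : C → C
        collapse = WF.All.wfRec wellFounded a (λ _ → C) next

        collapse-unfold : ∀ x → collapse x ≡ next x (λ {y} _ → collapse y)
        collapse-unfold x = FixPoint.unfold-wfRec wellFounded (λ _ → C) next next-ext

      Above : C → C → Set (a ⊔ ℓ)
      Above x v = ∀ {y} → y ∈⟨ lo , [ x ] ⟩ → collapse y < v

      Image : C ⁺ → C → Set (a ⊔ ℓ)
      Image hi v = ∃ λ y → y ∈⟨ lo , hi ⟩ × collapse y ≡ v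

      collapse-least-≤ : ∀ {x} → Above x x → least (Above x) ≡ [ collapse x ] × collapse x ≤ x
      collapse-least-≤ {x} above with least (Above x) in eq | least-minimal {P = Above x} above
      ... | [ m ] | [ m≤x ] = cong [_] (sym collapse≡m) , subst (_≤ x) (sym collapse≡m) m≤x
        where
        collapse≡m : collapse x ≡ m
        collapse≡m = trans (collapse-unfold x) (cong (fromMaybe x) eq)

      above-self : ∀ x → Above x x
      above-self = WF.All.wfRec wellFounded _ (λ x → Above x x) λ x ih y∈ →
        ≤-<-trans (proj₂ (collapse-least-≤ (ih ([<⁺]-injective (proj₂ y∈))))) ([<⁺]-injective (proj₂ y∈))

      collapse-least : ∀ x → least (Above x) ≡ [ collapse x ]
      collapse-least x = proj₁ (collapse-least-≤ (above-self x))

      collapse-mono : StrictlyMonotoneOn (λ x → lo <₋ [ x ]) collapse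
      collapse-mono lo<x _ x<y = least-sound (collapse-least _) (lo<x , [ x<y ])

      collapse-onto : ∀ x {v} → v < collapse x → Image [ x ] v
      collapse-onto = WF.All.wfRec wellFounded _ (λ x → ∀ {v} → v < collapse x → Image [ x ] v) onto
        where
        onto : ∀ x → (∀ {y} → y < x → ∀ {v} → v < collapse y → Image [ y ] v) →
               ∀ {v} → v < collapse x → Image [ x ] v
        onto x ih {v} v<cx
          with ¬∀⇒∃¬ (below-least (subst ([ _ ] <⁺_) (sym (collapse-least x)) [ v<cx ]))
        ... | y , y∈@(_ , [ y<x ]) , cy≮v with compare (collapse y) v
        ...   | tri< cy<v _ _ = ⊥-elim (cy≮v cy<v)
        ...   | tri≈ _ cy≡v _ = y , y∈ , cy≡v
        ...   | tri> _ _ v<cy with ih y<x v<cy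
        ...     | z , (lo<z , [ z<y ]) , cz≡v = z , (lo<z , [ <-trans z<y y<x ]) , cz≡v

    open Collapse using (collapse; collapse-mono; collapse-onto; Image)

    abstract
      -- The order type of the interval (lo, hi), as an element of α or ⊤⁺ for α itself.
      order-type : C ₋ → C ⁺ → C ⁺
      order-type lo hi = least (λ v → ¬ Image lo hi v)

      collapse<order-type : ∀ {lo hi x} → x ∈⟨ lo , hi ⟩ → [ collapse lo x ] <⁺ order-type lo hi
      collapse<order-type {lo} {hi} {x} x∈@(lo<x , x<hi) with order-type lo hi in eq
      ... | ⊤⁺    = [ _ ]<⊤⁺
      ... | [ d ] with compare (collapse lo x) d
      ...   | tri< cx<d _ _ = [ cx<d ]
      ...   | tri≈ _ cx≡d _ = ⊥-elim (least-sound eq (x , x∈ , cx≡d))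
      ...   | tri> _ _ d<cx with collapse-onto lo x d<cx
      ...     | y , (lo<y , y<x) , cy≡d =
              ⊥-elim (least-sound eq (y , (lo<y , <⁺-trans <-trans y<x x<hi) , cy≡d))

      <order-type⇒image : ∀ {lo hi v} → [ v ] <⁺ order-type lo hi → Image lo hi v
      <order-type⇒image v<type = stable (below-least v<type)

    <⁺-acc : ∀ {x} → Acc _<_ x → Acc _<⁺_ [ x ]
    <⁺-acc (acc rs) = acc λ { [ y<x ] → <⁺-acc (rs y<x) }

    <⁺-wellFounded : WellFounded _<⁺_
    <⁺-wellFounded [ x ] = <⁺-acc (wellFounded x)
    <⁺-wellFounded ⊤⁺    = acc λ { [ y ]<⊤⁺ → <⁺-acc (wellFounded y) }

    ≮⁺⇒≥⁺ : ∀ {x y} → ¬ y <⁺ x → x ≤⁺ y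
    ≮⁺⇒≥⁺ {x}     {⊤⁺}    _    = x ≤⊤⁺
    ≮⁺⇒≥⁺ {[ x ]} {[ y ]} y≮x  = [ ≮⇒≥ (y≮x ∘ [_]) ]
    ≮⁺⇒≥⁺ {⊤⁺}    {[ y ]} y≮⊤⁺ = ⊥-elim (y≮⊤⁺ [ y ]<⊤⁺)

    ≤⁺-wellQuasi : WellQuasi _≤⁺_
    ≤⁺-wellQuasi = well-founded⇒wellQuasi <⁺-wellFounded ≮⁺⇒≥⁺

    record IntervalEmbedding (lo : C ₋) (hi : C ⁺) (lo' : C ₋) (hi' : C ⁺) : Set (a ⊔ ℓ) where
      field
        to   : C → C
        into : ∀ {x} → x ∈⟨ lo , hi ⟩ → to x ∈⟨ lo' , hi' ⟩
        mono : StrictlyMonotoneOn _∈⟨ lo , hi ⟩ to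

    open IntervalEmbedding

    -- x goes to the point of (lo', hi') with the same position as x has in (lo, hi).
    order-type-≤⇒embedding : ∀ {lo hi lo' hi'} → order-type lo hi ≤⁺ order-type lo' hi' →
                             IntervalEmbedding lo hi lo' hi'
    order-type-≤⇒embedding {lo} {hi} {lo'} {hi'} type≤type' = record
      { to   = transfer
      ; into = λ x∈ → proj₁ (transfer-spec x∈)
      ; mono = λ {x} {y} x∈ y∈ x<y →
          reflects (collapse-mono lo') (proj₁ (proj₁ (transfer-spec x∈))) (proj₁ (proj₁ (transfer-spec y∈)))
            (subst₂ _<_ (sym (proj₂ (transfer-spec x∈))) (sym (proj₂ (transfer-spec y∈)))
              (collapse-mono lo (proj₁ x∈) (proj₁ y∈) x<y))
      }
      where
      Same : C → C → Set (a ⊔ ℓ)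
      Same x x' = x' ∈⟨ lo' , hi' ⟩ × collapse lo' x' ≡ collapse lo x

      transfer : C → C
      transfer x = ε (Same x) x

      transfer-spec : ∀ {x} → x ∈⟨ lo , hi ⟩ → Same x (transfer x)
      transfer-spec x∈ =
        ε-spec _ (<order-type⇒image (<⁺-transˡ <-≤-trans (collapse<order-type x∈) type≤type'))

    widen : ∀ {lo hi lo' hi' lo'' hi''} → (∀ {y} → y ∈⟨ lo' , hi' ⟩ → y ∈⟨ lo'' , hi'' ⟩) →
            IntervalEmbedding lo hi lo' hi' → IntervalEmbedding lo hi lo'' hi''
    widen ⊆ e = record { to = to e ; into = ⊆ ∘ into e ; mono = mono e }

    module Glue {lo lo' b b'} (f : IntervalEmbedding lo [ b ] lo' [ b' ])
                (g : IntervalEmbedding [ b ] ⊤⁺ [ b' ] ⊤⁺) (lo'<b' : lo' <₋ [ b' ]) where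

      glued : C → C
      glued x with compare x b
      ... | tri< _ _ _ = to f x
      ... | tri≈ _ _ _ = b'
      ... | tri> _ _ _ = to g x

      glued-at : glued b ≡ b'
      glued-at with compare b b
      ... | tri< b<b _ _ = ⊥-elim (<-irrefl refl b<b)
      ... | tri≈ _ _ _   = refl
      ... | tri> _ _ b<b = ⊥-elim (<-irrefl refl b<b)

      glued-above : ∀ {x} → b < x → glued x ≡ to g x
      glued-above {x} b<x with compare x b
      ... | tri< x<b _ _  = ⊥-elim (<-asym x<b b<x)
      ... | tri≈ _ refl _ = ⊥-elim (<-irrefl refl b<x)
      ... | tri> _ _ _    = refl

      f-below : ∀ {x} → lo <₋ [ x ] → x < b → to f x < b'
      f-below lo<x x<b = [<⁺]-injective (proj₂ (into f (lo<x , [ x<b ])))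

      g-above : ∀ {x} → b < x → b' < to g x
      g-above b<x = [<₋]-injective (proj₁ (into g ([ b<x ] , [ _ ]<⊤⁺)))

      glued-into : ∀ {x} → x ∈⟨ lo , ⊤⁺ ⟩ → glued x ∈⟨ lo' , ⊤⁺ ⟩
      glued-into {x} (lo<x , _) with compare x b
      ... | tri< x<b _ _ = proj₁ (into f (lo<x , [ x<b ])) , [ _ ]<⊤⁺
      ... | tri≈ _ _ _   = lo'<b' , [ _ ]<⊤⁺
      ... | tri> _ _ b<x = <₋-trans <-trans lo'<b' [ g-above b<x ] , [ _ ]<⊤⁺

      glued-mono : StrictlyMonotoneOn _∈⟨ lo , ⊤⁺ ⟩ glued
      glued-mono {x} {y} (lo<x , _) (lo<y , _) x<y with compare x b | compare y b
      ... | tri< x<b _ _  | tri< y<b _ _  = mono f (lo<x , [ x<b ]) (lo<y , [ y<b ]) x<y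
      ... | tri< x<b _ _  | tri≈ _ _ _    = f-below lo<x x<b
      ... | tri< x<b _ _  | tri> _ _ b<y  = <-trans (f-below lo<x x<b) (g-above b<y)
      ... | tri≈ _ refl _ | tri< y<b _ _  = ⊥-elim (<-asym x<y y<b)
      ... | tri≈ _ refl _ | tri≈ _ refl _ = ⊥-elim (<-irrefl refl x<y)
      ... | tri≈ _ _ _    | tri> _ _ b<y  = g-above b<y
      ... | tri> _ _ b<x  | tri< y<b _ _  = ⊥-elim (<-asym (<-trans b<x x<y) y<b)
      ... | tri> _ _ b<x  | tri≈ _ refl _ = ⊥-elim (<-asym b<x x<y)
      ... | tri> _ _ b<x  | tri> _ _ b<y  = mono g ([ b<x ] , [ _ ]<⊤⁺) ([ b<y ] , [ _ ]<⊤⁺) x<y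

      glued-embedding : IntervalEmbedding lo ⊤⁺ lo' ⊤⁺
      glued-embedding = record { to = glued ; into = glued-into ; mono = glued-mono }

    everywhere : ∀ x → x ∈⟨ ⊥₋ , ⊤⁺ ⟩
    everywhere x = ⊥₋<[ x ] , [ x ]<⊤⁺

    strictlyMonotone⇒embedding : ∀ {f} → StrictlyMonotoneOn _∈⟨ ⊥₋ , ⊤⁺ ⟩ f → IsEmbedding f
    strictlyMonotone⇒embedding {f} f-mono x y = preserves , reflects-≤
      where
      preserves : x ≤ y → f x ≤ f y
      preserves (inj₁ x<y)  = inj₁ (f-mono (everywhere x) (everywhere y) x<y)
      preserves (inj₂ refl) = inj₂ refl

      reflects-≤ : f x ≤ f y → x ≤ y
      reflects-≤ fx≤fy = ≮⇒≥ λ y<x → ≤⇒≯ fx≤fy (f-mono (everywhere y) (everywhere x) y<x)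

  module Words {a ℓ} (α : Ordinal a ℓ) {y r} {Y : Set y} {_≼_ : Rel Y r} where
    open Ordinal α renaming (Carrier to C)
    open IsStrictTotalOrder isStrictTotalOrder using (compare) renaming (trans to <-trans)
    open import Relation.Binary.Construct.Add.Infimum.Strict _<_ using (_<₋_; ⊥₋<[_]; [_]; <₋-trans)
    open import Relation.Binary.Construct.Add.Supremum.Strict _<_ using ([_]<⊤⁺)
    open import Relation.Binary.Construct.Add.Supremum.NonStrict _≤_ using (_≤⁺_; ≤⁺-trans)
    open Intervals α
    open IntervalEmbedding
    open Labellings α _≼_

    data Sorted : C ₋ → List (C × Y) → Set (a ⊔ ℓ ⊔ y) where
      []  : ∀ {lo} → Sorted lo []
      _∷_ : ∀ {lo b u L} → lo <₋ [ b ] → Sorted [ b ] L → Sorted lo ((b , u) ∷ L)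

    sorted-above : ∀ {lo L} → Sorted lo L → All (λ p → lo <₋ [ proj₁ p ]) L
    sorted-above []         = []
    sorted-above (lo<b ∷ S) = lo<b ∷ All.map (<₋-trans <-trans lo<b) (sorted-above S)

    insert : ∀ {lo L} b u → Sorted lo L → lo <₋ [ b ] → All (λ q → b ≢ proj₁ q) L →
             ∃ λ L' → Sorted lo L' × L' ↭ (b , u) ∷ L
    insert b u [] lo<b _ = _ , lo<b ∷ [] , ↭-refl
    insert b u (_∷_ {b = c} {v} lo<c S) lo<b (b≢c ∷ b∉L) with compare b c
    ... | tri< b<c _ _ = _ , lo<b ∷ [ b<c ] ∷ S , ↭-refl
    ... | tri≈ _ b≡c _ = ⊥-elim (b≢c b≡c)
    ... | tri> _ _ c<b with insert b u S [ c<b ] b∉L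
    ...   | L' , S' , L'↭ = _ , lo<c ∷ S' , ↭-trans (prep (c , v) L'↭) (swap (c , v) (b , u) ↭-refl)

    sorted-enumeration : ∀ l → AllPairs _≢_ (map proj₁ l) → ∃ λ L → Sorted ⊥₋ L × L ↭ l
    sorted-enumeration [] [] = [] , [] , ↭-refl
    sorted-enumeration ((b , u) ∷ l) (b∉l ∷ distinct) with sorted-enumeration l distinct
    ... | L , S , L↭l with insert b u S ⊥₋<[ b ] (All-resp-↭ (↭-sym L↭l) (map⁻ b∉l))
    ...   | L' , S' , L'↭ = L' , S' , ↭-trans L'↭ (prep (b , u) L↭l)

    enumerate : Labelling α Y → List (C × Y)
    enumerate (l , distinct) = proj₁ (sorted-enumeration l distinct)

    enumerate-sorted : ∀ l → Sorted ⊥₋ (enumerate l)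
    enumerate-sorted (l , distinct) = proj₁ (proj₂ (sorted-enumeration l distinct))

    enumerate-↭ : ∀ l → enumerate l ↭ proj₁ l
    enumerate-↭ (l , distinct) = proj₂ (proj₂ (sorted-enumeration l distinct))

    Letter : Set (a ⊔ y)
    Letter = C ⁺ × Y ₋

    _⊑_ : Rel Letter (a ⊔ ℓ ⊔ y ⊔ r)
    _⊑_ = Pointwise _≤⁺_ (_≤₋_ _≼_)

    word : C ₋ → List (C × Y) → List Letter
    word lo []            = (order-type lo ⊤⁺ , ⊥₋) ∷ []
    word lo ((b , u) ∷ L) = (order-type lo [ b ] , [ u ]) ∷ word [ b ] L

    above : ∀ {lo b} → lo <₋ [ b ] → ∀ {x} → x ∈⟨ [ b ] , ⊤⁺ ⟩ → x ∈⟨ lo , ⊤⁺ ⟩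
    above lo<b (b<x , x<⊤⁺) = <₋-trans <-trans lo<b b<x , x<⊤⁺

    sublist⇒embedding : ∀ {lo lo' L L'} → Sorted lo L → Sorted lo' L' →
                        Sublist _⊑_ (word lo L) (word lo' L') →
                        Σ (IntervalEmbedding lo ⊤⁺ lo' ⊤⁺) λ e → Carries (to e) L L'
    sublist⇒embedding [] [] ((type≤ , _) ∷ _) = order-type-≤⇒embedding type≤ , []
    sublist⇒embedding [] [] (_ ∷ʳ ())
    sublist⇒embedding [] (_ ∷ _) ((type≤ , _) ∷ _) =
      widen (λ (lo'<x , _) → lo'<x , [ _ ]<⊤⁺) (order-type-≤⇒embedding type≤) , []
    sublist⇒embedding (_ ∷ _) [] ((_ , ()) ∷ _)
    sublist⇒embedding (_ ∷ _) [] (_ ∷ʳ ())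
    sublist⇒embedding S (lo'<b' ∷ S') (_ ∷ʳ sub) with sublist⇒embedding S S' sub
    ... | e , carries = widen (above lo'<b') e , All.map there carries
    sublist⇒embedding (_ ∷ S) (lo'<b' ∷ S') ((type≤ , [ u≼u' ]) ∷ sub) with sublist⇒embedding S S' sub
    ... | g , carries =
          glued-embedding , here (sym glued-at , u≼u') ∷ carries-resp agrees (All.map there carries)
      where
      open Glue (order-type-≤⇒embedding type≤) g lo'<b'
      agrees : All (λ p → to g (proj₁ p) ≡ glued (proj₁ p)) _
      agrees = All.map (λ { [ b<x ] → sym (glued-above b<x) }) (sorted-above S)

    word-sublist⇒⇝ : ∀ l l' → Sublist _⊑_ (word ⊥₋ (enumerate l)) (word ⊥₋ (enumerate l')) → _⇝_ α _≼_ l l'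
    word-sublist⇒⇝ l l' sub =
      let e , carries = sublist⇒embedding (enumerate-sorted l) (enumerate-sorted l') sub
      in to e , strictlyMonotone⇒embedding (mono e) , carries-↭ (enumerate-↭ l) (enumerate-↭ l') carries

    module _ (≼-isPreorder : IsPreorder _≡_ _≼_) (≼-wq : WellQuasi _≼_) where
      open IsPreorder ≼-isPreorder using () renaming (trans to ≼-trans)

      ⊑-trans : Transitive _⊑_
      ⊑-trans = ×-transitive {R = _≤⁺_} {S = _≤₋_ _≼_} (≤⁺-trans ≤-trans) (≤₋-trans _≼_ ≼-trans)

      ⊑-wellQuasi : WellQuasi _⊑_
      ⊑-wellQuasi =
        ×-wellQuasi {R = _≤⁺_} {Q = _≤₋_ _≼_} (≤⁺-trans ≤-trans) ≤⁺-wellQuasi (≤₋-wellQuasi {_≤_ = _≼_} ≼-wq)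

      ⇝-wellQuasi : WellQuasi (_⇝_ α _≼_)
      ⇝-wellQuasi s =
        let i , j , i<j , wi⊑*wj = Higman.higman {_≤_ = _⊑_} ⊑-trans ⊑-wellQuasi (word ⊥₋ ∘ enumerate ∘ s)
        in i , j , i<j , word-sublist⇒⇝ (s i) (s j) wi⊑*wj

lemma2p2 : LEM → ∀ {a ℓ : Level} (α : Ordinal a ℓ) → WellStructured α
lemma2p2 lem α Y _≼_ (≼-isPreorder , ≼-wq) =
  ⇝-isPreorder ≼-isPreorder , Words.⇝-wellQuasi α ≼-isPreorder ≼-wq
  where
  open Classical lem
  open Labellings α _≼_
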